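{- Let $n\in\mathbb N$ and $0\le r<n$, and let $s=\lfloor r/2\rfloor$. (i) If $r=2s$, then $Y(n,r)$ consists exactly of those elements of $W(n,r)$ in which $\{s+1\}$ is a singleton block. (ii) If $r=2s+1$, then $Y(n,r)$ consists exactly of those elements of $W(n,r)$ in which $s+1$ and $s+2$ lie in the same block. Moreover $Y(n,n-1)=W(n,n-1)$.
   Context: For $n\in\mathbb N$ let $\mathcal{NC}(0,n)$ be the set of non-crossing partitions of $\{1,\dots,n\}$. For $0\le r<n$ with $s=\lfloor r/2\rfloor$: if $r=2s$, $W(n,r)$ is the set of $p\in\mathcal{NC}(0,n)$ in which none of $1,\dots,s$ is a singleton and $1,\dots,s+1$ lie in pairwise different blocks; if $r=2s+1$, $W(n,r)$ is the set of $p\in\mathcal{NC}(0,n)$ in which none of $1,\dots,s+1$ is a singleton and they lie in pairwise different blocks. Set $W(n,n)=\emptyset$ and $Y(n,r)=W(n,r)\setminus W(n,r+1)$ for $0\le r<n$. -}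

module Defs where

open import Data.Nat using (ℕ; zero; suc; _*_; _≤_; _<_)
open import Data.Nat.DivMod using (_/_)
open import Data.Fin using (Fin; toℕ)
import Data.Fin as F
open import Data.Product using (_×_; Σ; ∃)
open import Data.Sum using (_⊎_)
open import Relation.Nullary using (¬_)
open import Relation.Binary.PropositionalEquality using (_≡_)

-- A set partition of {1,…,n} is represented by a block-labelling
-- p : Fin n → ℕ ; positions are 0-indexed (Fin index k-1 is element k),
-- and two elements lie in the same block iff their labels agree.
Labelling : ℕ → Set
Labelling n = Fin n → ℕ

SameBlock : ∀ {n} → Labelling n → Fin n → Fin n → Set
SameBlock p i j = p i ≡ p j

Singleton : ∀ {n} → Labelling n → Fin n → Set
Singleton {n} p i = ∀ (j : Fin n) → SameBlock p j i → j ≡ i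

NonCrossing : ∀ {n} → Labelling n → Set
NonCrossing {n} p = ∀ (a b c d : Fin n) → a F.< b → b F.< c → c F.< d →
  SameBlock p a c → SameBlock p b d → SameBlock p a b

PairwiseDistinctUpTo : ∀ {n} → Labelling n → ℕ → Set
PairwiseDistinctUpTo {n} p s = ∀ (i j : Fin n) → toℕ i ≤ s → toℕ j ≤ s → SameBlock p i j → i ≡ j

-- r = 2s : none of 1,…,s is a singleton and 1,…,s+1 pairwise in different blocks
WEven : ∀ {n} → Labelling n → ℕ → Set
WEven {n} p s = (∀ (i : Fin n) → toℕ i < s → ¬ Singleton p i) × PairwiseDistinctUpTo p s

-- r = 2s+1 : none of 1,…,s+1 is a singleton and they are pairwise in different blocks
WOdd : ∀ {n} → Labelling n → ℕ → Set
WOdd {n} p s = (∀ (i : Fin n) → toℕ i ≤ s → ¬ Singleton p i) × PairwiseDistinctUpTo p s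

-- W(n,r) (membership predicate, for non-crossing p); empty unless r < n
W : (n r : ℕ) → Labelling n → Set
W n r p = r < n × ((r ≡ 2 * (r / 2) × WEven p (r / 2)) ⊎ (r ≡ suc (2 * (r / 2)) × WOdd p (r / 2)))

Y : (n r : ℕ) → Labelling n → Set
Y n r p = W n r p × ¬ W n (suc r) p

SingletonAt : ∀ {n} → Labelling n → ℕ → Set
SingletonAt {n} p k = Σ (Fin n) λ i → toℕ i ≡ k × Singleton p i

SameBlockAt : ∀ {n} → Labelling n → ℕ → ℕ → Set
SameBlockAt {n} p k l = Σ (Fin n) λ i → Σ (Fin n) λ j → toℕ i ≡ k × toℕ j ≡ l × SameBlock p i j

module Submission where

-- Positions are 0-indexed, so s = r / 2 is the position of the element s+1.
-- Membership in W(n,r+1) adds exactly one condition to membership in W(n,r),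
-- besides r+1 < n:
--   * r = 2s   : the element at position s is not a singleton;
--   * r = 2s+1 : the element at position s+1 is in a block different from
--                those of positions 0,…,s.
-- So the theorem amounts to two facts about a non-crossing p ∈ W(n,r).
-- (a) Room: if the extra condition holds, then automatically r+1 < n.  This
--     comes from a nesting argument: if position s has a block-mate j > s,
--     non-crossing forces the blocks of s-1, s-2, …, 0 to reach strictly
--     further right each time, so n > toℕ j + s.
-- (b) Odd case: position s+1 is in a block different from those of 0,…,s as
--     soon as it is not in the block of s, since a block-mate x < s of s+1
--     would cross the arc from s to its block-mate beyond s+1.
-- The file reads off W for each parity of the index, proves the nesting
-- bound, derives (a) and (b), characterises Y in both parities and in the
-- last case r = n-1 (where W(n,n) is empty), and assembles lemma5p11.

open import Defs
open import Data.Nat using (ℕ; zero; suc; _+_; _*_; _<_; _≤_; z≤n; s≤s; z<s)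
open import Data.Nat.DivMod using (_/_; m*n/n≡m; +-distrib-/-∣ʳ)
open import Data.Nat.Divisibility using (divides-refl)
open import Data.Nat.Properties
open import Data.Fin using (Fin; toℕ; fromℕ<)
open import Data.Fin.Properties using (toℕ-injective; toℕ-fromℕ<; toℕ<n; all?; ¬∀⟶∃¬)
  renaming (_≟_ to _≟ᶠ_)
open import Data.Product using (_×_; _,_; proj₁; proj₂; Σ)
open import Data.Sum using (inj₁; inj₂)
open import Data.Empty using (⊥-elim)
open import Function.Bundles using (_⇔_; mk⇔; Equivalence)
open import Relation.Nullary using (¬_; Dec; yes; no)
open import Relation.Nullary.Decidable using (_→-dec_)
open import Relation.Binary.PropositionalEquality using (_≡_; refl; sym; trans; cong; subst; subst₂)
open import Relation.Binary.Definitions using (tri<; tri≈; tri>)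

half-even : ∀ s → 2 * s / 2 ≡ s
half-even s = trans (cong (_/ 2) (*-comm 2 s)) (m*n/n≡m s 2)

half-odd : ∀ s → suc (2 * s) / 2 ≡ s
half-odd s = trans (cong (λ m → suc m / 2) (*-comm 2 s))
                   (trans (+-distrib-/-∣ʳ 1 {d = 2} (divides-refl s)) (m*n/n≡m s 2))

W-even : ∀ {n r s} {p : Labelling n} → r ≡ 2 * s → W n r p ⇔ (r < n × WEven p s)
W-even {s = s} {p} refl = mk⇔ to from
  where
  to : W _ (2 * s) p → 2 * s < _ × WEven p s
  to (r<n , inj₁ (_ , w))   = r<n , subst (WEven p) (half-even s) w
  to (_   , inj₂ (odd , _)) = ⊥-elim (even≢odd s (2 * s / 2) odd)

  from : 2 * s < _ × WEven p s → W _ (2 * s) p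
  from (r<n , w) = r<n , inj₁ (cong (2 *_) (sym (half-even s)) , subst (WEven p) (sym (half-even s)) w)

W-odd : ∀ {n r s} {p : Labelling n} → r ≡ suc (2 * s) → W n r p ⇔ (r < n × WOdd p s)
W-odd {s = s} {p} refl = mk⇔ to from
  where
  to : W _ (suc (2 * s)) p → suc (2 * s) < _ × WOdd p s
  to (_   , inj₁ (even , _)) = ⊥-elim (even≢odd (suc (2 * s) / 2) s (sym even))
  to (r<n , inj₂ (_ , w))    = r<n , subst (WOdd p) (half-odd s) w

  from : suc (2 * s) < _ × WOdd p s → W _ (suc (2 * s)) p
  from (r<n , w) = r<n , inj₂ (cong (λ m → suc (2 * m)) (sym (half-odd s)) , subst (WOdd p) (sym (half-odd s)) w)

not-other-mate? : ∀ {n} (p : Labelling n) (i j : Fin n) → Dec (SameBlock p j i → j ≡ i)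
not-other-mate? p i j = (p j ≟ p i) →-dec (j ≟ᶠ i)

singleton? : ∀ {n} (p : Labelling n) (i : Fin n) → Dec (Singleton p i)
singleton? p i = all? (not-other-mate? p i)

partner : ∀ {n} (p : Labelling n) (i : Fin n) → ¬ Singleton p i →
  Σ (Fin n) λ k → ¬ k ≡ i × p k ≡ p i
partner {n} p i nsing with ¬∀⟶∃¬ n _ (not-other-mate? p i) nsing
... | k , not-alone with p k ≟ p i | k ≟ᶠ i
...   | yes same | no k≢i   = k , k≢i , same
...   | yes _    | yes k≡i  = ⊥-elim (not-alone (λ _ → k≡i))
...   | no diff  | _        = ⊥-elim (not-alone (λ same → ⊥-elim (diff same)))

mate-beyond : ∀ {n s} {p : Labelling n} → PairwiseDistinctUpTo p s →
  (i : Fin n) → toℕ i ≤ s → ¬ Singleton p i → Σ (Fin n) λ k → p k ≡ p i × s < toℕ k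
mate-beyond {s = s} {p} pd i i≤s nsing with partner p i nsing
... | k , k≢i , k~i with toℕ k ≤? s
...   | yes k≤s = ⊥-elim (k≢i (pd k i k≤s i≤s k~i))
...   | no k≰s  = k , k~i , ≰⇒> k≰s

neighbours-apart : ∀ {n s} {p : Labelling n} → PairwiseDistinctUpTo p s →
  (i i' : Fin n) → toℕ i < s → toℕ i' ≡ suc (toℕ i) → ¬ p i ≡ p i'
neighbours-apart pd i i' i<s i'≡ same =
  1+n≢n (trans (sym i'≡) (cong toℕ (sym (pd i i' (<⇒≤ i<s) (subst (_≤ _) (sym i'≡) i<s) same))))

-- Any
-- block-mate q of i' is overtaken by a block-mate k of i, since k lies
-- beyond s ≥ i', and k < q would make the arcs i–k and i'–q cross.
nest-step : ∀ {n s} {p : Labelling n} → NonCrossing p → PairwiseDistinctUpTo p s →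
  (i i' : Fin n) → toℕ i < s → toℕ i' ≡ suc (toℕ i) → ¬ Singleton p i →
  (q : Fin n) → p q ≡ p i' → Σ (Fin n) λ k → p k ≡ p i × toℕ q < toℕ k
nest-step {s = s} {p} nc pd i i' i<s i'≡ nsing q q~i'
  with mate-beyond pd i (<⇒≤ i<s) nsing
... | k , k~i , s<k with <-cmp (toℕ q) (toℕ k)
...   | tri< q<k _ _ = k , k~i , q<k
...   | tri≈ _ q≡k _ = ⊥-elim (neighbours-apart pd i i' i<s i'≡
                         (trans (sym k~i) (trans (cong p (toℕ-injective (sym q≡k))) q~i')))
...   | tri> _ _ k<q = ⊥-elim (neighbours-apart pd i i' i<s i'≡
                         (nc i i' k q i<i' i'<k k<q (sym k~i) (sym q~i')))
  where
  i<i' : toℕ i < toℕ i'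
  i<i' = subst (toℕ i <_) (sym i'≡) (n<1+n (toℕ i))

  i'<k : toℕ i' < toℕ k
  i'<k = ≤-<-trans (subst (_≤ s) (sym i'≡) i<s) s<k

nest-chain : ∀ {n s} {p : Labelling n} → NonCrossing p →
  (∀ i → toℕ i < s → ¬ Singleton p i) → PairwiseDistinctUpTo p s →
  (top j : Fin n) → toℕ top ≡ s → p j ≡ p top →
  ∀ d (i : Fin n) → toℕ i + d ≡ s → Σ (Fin n) λ q → p q ≡ p i × toℕ j + d ≤ toℕ q
nest-chain {p = p} nc ns pd top j top≡s j~top zero i i≡s =
  j , trans j~top (cong p top≡i) , ≤-reflexive (+-identityʳ (toℕ j))
  where
  top≡i : top ≡ i
  top≡i = toℕ-injective (trans top≡s (trans (sym i≡s) (+-identityʳ (toℕ i))))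
nest-chain {n} {s} {p} nc ns pd top j top≡s j~top (suc d) i i+d≡s =
  let (q , q~i' , j+d≤q) = nest-chain nc ns pd top j top≡s j~top d i' i'+d≡s
      (k , k~i , q<k)    = nest-step nc pd i i' i<s (toℕ-fromℕ< i'<n) (ns i i<s) q q~i'
  in  k , k~i , subst (_≤ toℕ k) (sym (+-suc (toℕ j) d)) (≤-<-trans j+d≤q q<k)
  where
  i<s : toℕ i < s
  i<s = subst (toℕ i <_) i+d≡s (m<m+n (toℕ i) z<s)

  i'<n : suc (toℕ i) < n
  i'<n = ≤-<-trans i<s (subst (_< n) top≡s (toℕ<n top))

  i' : Fin n
  i' = fromℕ< i'<n

  i'+d≡s : toℕ i' + d ≡ s
  i'+d≡s = trans (cong (_+ d) (toℕ-fromℕ< i'<n)) (trans (sym (+-suc (toℕ i) d)) i+d≡s)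

-- The nesting bound: a block-mate j of position s satisfies j + s < n,
-- because the block of position 0 reaches j + s.
nesting-bound : ∀ {n s} {p : Labelling n} → NonCrossing p →
  (∀ i → toℕ i < s → ¬ Singleton p i) → PairwiseDistinctUpTo p s →
  (top j : Fin n) → toℕ top ≡ s → p j ≡ p top → toℕ j + s < n
nesting-bound {n} {s} nc ns pd top j top≡s j~top =
  let (q , _ , j+s≤q) = nest-chain nc ns pd top j top≡s j~top s first (cong (_+ s) (toℕ-fromℕ< 0<n))
  in  ≤-<-trans j+s≤q (toℕ<n q)
  where
  0<n : 0 < n
  0<n = ≤-<-trans z≤n (toℕ<n top)

  first : Fin n
  first = fromℕ< 0<n

double-bound : ∀ {s k} m → m + s ≤ k → m + 2 * s ≤ k + s
double-bound {s} {k} m m+s≤k = subst (_≤ k + s) m+s+s≡m+2s (+-monoˡ-≤ s m+s≤k)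
  where
  m+s+s≡m+2s : m + s + s ≡ m + 2 * s
  m+s+s≡m+2s = trans (+-assoc m s s) (cong (λ t → m + (s + t)) (sym (+-identityʳ s)))

even-room : ∀ {n s} {p : Labelling n} → NonCrossing p → WEven p s →
  (top : Fin n) → toℕ top ≡ s → ¬ Singleton p top → suc (2 * s) < n
even-room nc (ns , pd) top top≡s nsing =
  let (k , k~top , s<k) = mate-beyond pd top (≤-reflexive top≡s) nsing
  in  ≤-<-trans (double-bound 1 s<k) (nesting-bound nc ns pd top k top≡s k~top)

mate-beyond-next : ∀ {n s} {p : Labelling n} → PairwiseDistinctUpTo p s →
  (top next : Fin n) → toℕ top ≡ s → toℕ next ≡ suc s → ¬ p top ≡ p next →
  ¬ Singleton p top → Σ (Fin n) λ k → p k ≡ p top × suc s < toℕ k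
mate-beyond-next {p = p} pd top next top≡s next≡ apart nsing
  with mate-beyond pd top (≤-reflexive top≡s) nsing
... | k , k~top , s<k with m≤n⇒m<n∨m≡n s<k
...   | inj₁ s+1<k = k , k~top , s+1<k
...   | inj₂ k≡s+1 = ⊥-elim (apart (trans (sym k~top) (cong p (toℕ-injective (trans (sym k≡s+1) (sym next≡))))))

odd-room : ∀ {n s} {p : Labelling n} → NonCrossing p → WOdd p s →
  (top next : Fin n) → toℕ top ≡ s → toℕ next ≡ suc s → ¬ p top ≡ p next →
  suc (suc (2 * s)) < n
odd-room nc (ns , pd) top next top≡s next≡ apart =
  let (k , k~top , s+1<k) = mate-beyond-next pd top next top≡s next≡ apart (ns top (≤-reflexive top≡s))
  in  ≤-<-trans (double-bound 2 s+1<k) (nesting-bound nc (λ i i<s → ns i (<⇒≤ i<s)) pd top k top≡s k~top)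

-- A block-mate x < s of s+1 would cross the arc from s to its mate beyond s+1.
fresh-next : ∀ {n s} {p : Labelling n} → NonCrossing p → WOdd p s →
  (top next : Fin n) → toℕ top ≡ s → toℕ next ≡ suc s → ¬ p top ≡ p next →
  (x : Fin n) → toℕ x ≤ s → ¬ p x ≡ p next
fresh-next {s = s} {p} nc (ns , pd) top next top≡s next≡ apart x x≤s x~next
  with m≤n⇒m<n∨m≡n x≤s
... | inj₂ x≡s = apart (trans (cong p (toℕ-injective (trans top≡s (sym x≡s)))) x~next)
... | inj₁ x<s =
  let (k , k~top , s+1<k) = mate-beyond-next pd top next top≡s next≡ apart (ns top (≤-reflexive top≡s))
      x~top = nc x top next k (subst (toℕ x <_) (sym top≡s) x<s)
                (subst₂ _<_ (sym top≡s) (sym next≡) (n<1+n s)) (subst (_< toℕ k) (sym next≡) s+1<k) x~next (sym k~top)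
  in  <-irrefl (cong toℕ (pd x top x≤s (≤-reflexive top≡s) x~top))
               (subst (toℕ x <_) (sym top≡s) x<s)

distinct-snoc : ∀ {n s} {p : Labelling n} → PairwiseDistinctUpTo p s →
  (next : Fin n) → toℕ next ≡ suc s → (∀ x → toℕ x ≤ s → ¬ p x ≡ p next) →
  PairwiseDistinctUpTo p (suc s)
distinct-snoc {p = p} pd next next≡ fresh i j i≤ j≤ i~j
  with m≤n⇒m<n∨m≡n i≤ | m≤n⇒m<n∨m≡n j≤
... | inj₁ i< | inj₁ j< = pd i j (≤-pred i<) (≤-pred j<) i~j
... | inj₁ i< | inj₂ j≡ = ⊥-elim (fresh i (≤-pred i<) (trans i~j (cong p (toℕ-injective (trans j≡ (sym next≡))))))
... | inj₂ i≡ | inj₁ j< = ⊥-elim (fresh j (≤-pred j<) (trans (sym i~j) (cong p (toℕ-injective (trans i≡ (sym next≡))))))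
... | inj₂ i≡ | inj₂ j≡ = toℕ-injective (trans i≡ (sym j≡))

nonsingleton-snoc : ∀ {n s} {p : Labelling n} → (∀ i → toℕ i < s → ¬ Singleton p i) →
  (top : Fin n) → toℕ top ≡ s → ¬ Singleton p top → ∀ i → toℕ i ≤ s → ¬ Singleton p i
nonsingleton-snoc {p = p} ns top top≡s nsing i i≤s with m≤n⇒m<n∨m≡n i≤s
... | inj₁ i<s = ns i i<s
... | inj₂ i≡s = subst (λ k → ¬ Singleton p k) (toℕ-injective (trans top≡s (sym i≡s))) nsing

Y-even : ∀ {n r s} (p : Labelling n) → NonCrossing p → r < n → r ≡ 2 * s →
  Y n r p ⇔ (W n r p × SingletonAt p s)
Y-even {n} {r} {s} p nc r<n r≡2s = mk⇔ to from
  where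
  W-next : W n (suc r) p ⇔ (suc r < n × WOdd p s)
  W-next = W-odd (cong suc r≡2s)

  s<n : s < n
  s<n = ≤-<-trans (subst (s ≤_) (sym r≡2s) (m≤m+n s _)) r<n

  top : Fin n
  top = fromℕ< s<n

  top≡s : toℕ top ≡ s
  top≡s = toℕ-fromℕ< s<n

  to : Y n r p → W n r p × SingletonAt p s
  to (w , not-next) with singleton? p top
  ... | yes sing  = w , top , top≡s , sing
  ... | no nsing  = ⊥-elim (not-next (Equivalence.from W-next (room , nonsingleton-snoc ns top top≡s nsing , pd)))
    where
    we : WEven p s
    we = proj₂ (Equivalence.to (W-even r≡2s) w)

    ns : ∀ i → toℕ i < s → ¬ Singleton p i
    ns = proj₁ we

    pd : PairwiseDistinctUpTo p s
    pd = proj₂ we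

    room : suc r < n
    room = subst (λ m → suc m < n) (sym r≡2s) (even-room nc we top top≡s nsing)

  from : W n r p × SingletonAt p s → Y n r p
  from (w , i , i≡s , sing) =
    w , λ next → proj₁ (proj₂ (Equivalence.to W-next next)) i (≤-reflexive i≡s) sing

Y-odd : ∀ {n r s} (p : Labelling n) → NonCrossing p → r < n → r ≡ suc (2 * s) →
  Y n r p ⇔ (W n r p × SameBlockAt p s (suc s))
Y-odd {n} {r} {s} p nc r<n r≡ = mk⇔ to from
  where
  W-next : W n (suc r) p ⇔ (suc r < n × WEven p (suc s))
  W-next = W-even (trans (cong suc r≡) (sym (*-suc 2 s)))

  s+1<n : suc s < n
  s+1<n = ≤-<-trans (subst (suc s ≤_) (sym r≡) (s≤s (m≤m+n s _))) r<n

  top next : Fin n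
  top  = fromℕ< (<-trans (n<1+n s) s+1<n)
  next = fromℕ< s+1<n

  top≡s : toℕ top ≡ s
  top≡s = toℕ-fromℕ< _

  next≡ : toℕ next ≡ suc s
  next≡ = toℕ-fromℕ< s+1<n

  to : Y n r p → W n r p × SameBlockAt p s (suc s)
  to (w , not-next) with p top ≟ p next
  ... | yes same  = w , top , next , top≡s , next≡ , same
  ... | no apart  = ⊥-elim (not-next (Equivalence.from W-next (room , ns′ , pd′)))
    where
    wo : WOdd p s
    wo = proj₂ (Equivalence.to (W-odd r≡) w)

    room : suc r < n
    room = subst (λ m → suc m < n) (sym r≡) (odd-room nc wo top next top≡s next≡ apart)

    ns′ : ∀ i → toℕ i < suc s → ¬ Singleton p i
    ns′ i i<s+1 = proj₁ wo i (≤-pred i<s+1)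

    pd′ : PairwiseDistinctUpTo p (suc s)
    pd′ = distinct-snoc (proj₂ wo) next next≡ (fresh-next nc wo top next top≡s next≡ apart)

  from : W n r p × SameBlockAt p s (suc s) → Y n r p
  from (w , i , j , i≡s , j≡ , same) = w , λ nxt →
    let pd′ = proj₂ (proj₂ (Equivalence.to W-next nxt))
        i≡j = pd′ i j (≤-trans (≤-reflexive i≡s) (n≤1+n s)) (≤-reflexive j≡) same
    in  1+n≢n (trans (sym j≡) (trans (cong toℕ (sym i≡j)) i≡s))

-- Y(n,n-1) = W(n,n-1), since W(n,n) is empty: W requires its index below n.
Y-last : ∀ {n r} (p : Labelling n) → suc r ≡ n → Y n r p ⇔ W n r p
Y-last p r+1≡n = mk⇔ proj₁ (λ w → w , λ next → <-irrefl r+1≡n (proj₁ next))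

lemma5p11 : ∀ (n r : ℕ) → r < n → (p : Labelling n) → NonCrossing p →
    (r ≡ 2 * (r / 2) → (Y n r p ⇔ (W n r p × SingletonAt p (r / 2))))
    × (r ≡ suc (2 * (r / 2)) → (Y n r p ⇔ (W n r p × SameBlockAt p (r / 2) (suc (r / 2)))))
    × (suc r ≡ n → (Y n r p ⇔ W n r p))
lemma5p11 n r r<n p nc = Y-even p nc r<n , Y-odd p nc r<n , Y-last p
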